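{- Let $(a_n)_{n\ge 1}$ be defined by $a_1=1$, $a_2=2$ and $a_{n+1}=n\,a_n+a_{n-1}$ for $n\ge 2$. For each $n$, let $G_n$ be the total number of gaps, and $N_n$ the total number of gaps of nonzero length, in the legal decompositions of all integers $m\in[a_n,a_{n+1})$. Then $N_n/G_n\to 0$ as $n\to\infty$.
   Context: A legal decomposition of a positive integer $m$ is a representation $m=\sum_{i} s_i a_i$ with $s_i\in\{0,1,\ldots,i\}$ and such that if $s_i=i$ then $s_{i-1}=0$; it exists and is unique. Listing the summands of this decomposition with multiplicity (the index $i$ appearing $s_i$ times) in nondecreasing order of index, the gaps of the decomposition are the differences of indices between each pair of adjacent summands in this list. Two identical adjacent summands give a gap of length zero; adjacent distinct summands $a_i, a_j$ ($i<j$) give a gap of nonzero length $j-i$. -}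

module Defs where

open import Data.Nat using (ℕ; zero; suc; _+_; _*_; _∸_; _≤_)
open import Data.List using (List; []; _∷_; _++_; replicate; length; filter; map; upTo)
open import Data.Nat.ListAction using (sum)
open import Data.Product using (_×_)
open import Data.Unit using (⊤)
open import Relation.Binary.PropositionalEquality using (_≡_; _≢_)
open import Relation.Nullary using (¬_)
open import Relation.Nullary.Decidable using (¬?)
open import Data.Nat using (_≟_)

-- a 1 = 1, a 2 = 2, a (n+1) = n * a n + a (n-1) for n ≥ 2.  (a 0 is unused; set to 0.)
a : ℕ → ℕ
a zero = 0
a (suc zero) = 1
a (suc (suc zero)) = 2
a (suc (suc (suc k))) = suc (suc k) * a (suc (suc k)) + a (suc k)

-- A decomposition is a coefficient list  [s_1, s_2, ..., s_k]  (list position j ↦ s_{j+1}).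

valueFrom : ℕ → List ℕ → ℕ
valueFrom i [] = 0
valueFrom i (x ∷ xs) = x * a i + valueFrom (suc i) xs

value : List ℕ → ℕ
value = valueFrom 1

-- legality: s_i ∈ {0,…,i}, and s_i = i ⇒ s_{i-1} = 0 (p is the previous coefficient; s_0 := 0)
legalFrom : ℕ → ℕ → List ℕ → Set
legalFrom i p [] = ⊤
legalFrom i p (x ∷ xs) = (x ≤ i) × (x ≡ i → p ≡ 0) × legalFrom (suc i) x xs

Legal : List ℕ → Set
Legal = legalFrom 1 0

LegalDecomp : List ℕ → ℕ → Set
LegalDecomp s m = Legal s × value s ≡ m

summandsFrom : ℕ → List ℕ → List ℕ
summandsFrom i [] = []
summandsFrom i (x ∷ xs) = replicate x i ++ summandsFrom (suc i) xs

summands : List ℕ → List ℕ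
summands = summandsFrom 1

gaps : List ℕ → List ℕ
gaps (x ∷ y ∷ r) = (y ∸ x) ∷ gaps (y ∷ r)
gaps _ = []

numGaps : List ℕ → ℕ
numGaps s = length (gaps (summands s))

numNonzeroGaps : List ℕ → ℕ
numNonzeroGaps s = length (filter (λ g → ¬? (g ≟ 0)) (gaps (summands s)))

range : ℕ → List ℕ
range n = map (λ j → a n + j) (upTo (a (suc n) ∸ a n))

-- G_n and N_n, computed with respect to a choice dec m of decomposition for each m
G : (ℕ → List ℕ) → ℕ → ℕ
G dec n = sum (map (λ m → numGaps (dec m)) (range n))

N : (ℕ → List ℕ) → ℕ → ℕ
N dec n = sum (map (λ m → numNonzeroGaps (dec m)) (range n))

{-# OPTIONS --safe #-}
module Submission where

open import Defs
open import Data.Nat using (ℕ; _*_; _≤_)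
open import Data.Product using (∃-syntax)
open import Data.List using (List)

open import Data.Nat
  using (zero; suc; _+_; _∸_; _<_; _≤′_; ≤′-refl; ≤′-step; z≤n; s≤s; z<s; s<s; NonZero; >-nonZero; _≟_; _≤?_)
open import Data.Nat.Properties
open import Data.Nat.DivMod
  using (_/_; _%_; +-distrib-/-∣ˡ; m*n/n≡m; m<n⇒m/n≡0; [m+kn]%n≡m%n; m<n⇒m%n≡m)
open import Data.Nat.Divisibility using (n∣m*n)
open import Data.Nat.ListAction using (sum)
open import Data.Nat.Tactic.RingSolver using (solve-∀)
open import Data.List using ([]; _∷_; _++_; replicate; length; filter; map; applyUpTo; upTo)
open import Data.List.Properties using (length-++; length-replicate; map-∘)
open import Data.Product using (_×_; _,_; proj₁)
open import Data.Sum using (_⊎_; inj₁; inj₂)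
open import Data.Bool using (true; false)
open import Function using (_∘_; id)
open import Relation.Binary.PropositionalEquality
open import Relation.Nullary using (yes; no; does; contradiction)
open import Relation.Nullary.Decidable using (¬?)

-- Legality forces Σ_{i ≤ j} s_i a_i < a_{j+1} for every j, so the legal decomposition of m is the
-- greedy one and its number of summands is the greedy digit sum of m; the number of gaps is that
-- digit sum minus one.  The summands are sorted, so each nonzero gap raises the index and
-- N_n ≤ n (a_{n+1} − a_n) ≤ n³ a_{n−1}.  On the other hand, cutting [0, a_{q+1}) into the blocks
-- on which the leading digit is constant shows that the digit sums below a_{q+1} total at least
-- a_q (q+1 choose 3), and those over [a_n, a_{n+1}) total at least n − 1 times the sum below a_n.
-- Hence G_n grows at least like n⁴ a_{n−1} / 6, and G_n / N_n → ∞.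

∑ : (ℕ → ℕ) → ℕ → ℕ
∑ f zero = 0
∑ f (suc n) = f 0 + ∑ (f ∘ suc) n

∑-cong : ∀ {f g} n → (∀ j → j < n → f j ≡ g j) → ∑ f n ≡ ∑ g n
∑-cong zero _ = refl
∑-cong (suc n) f≡g = cong₂ _+_ (f≡g 0 z<s) (∑-cong n (λ j j< → f≡g (suc j) (s<s j<)))

∑-mono-≤ : ∀ {f g} n → (∀ j → j < n → f j ≤ g j) → ∑ f n ≤ ∑ g n
∑-mono-≤ zero _ = z≤n
∑-mono-≤ (suc n) f≤g = +-mono-≤ (f≤g 0 z<s) (∑-mono-≤ n (λ j j< → f≤g (suc j) (s<s j<)))

∑-const : ∀ c n → ∑ (λ _ → c) n ≡ n * c
∑-const c zero = refl
∑-const c (suc n) = cong (c +_) (∑-const c n)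

∑-distrib-+ : ∀ f g n → ∑ (λ j → f j + g j) n ≡ ∑ f n + ∑ g n
∑-distrib-+ f g zero = refl
∑-distrib-+ f g (suc n) =
  trans (cong (f 0 + g 0 +_) (∑-distrib-+ (f ∘ suc) (g ∘ suc) n)) (interchange (f 0) (g 0) _ _)
  where
  interchange : ∀ u v w x → (u + v) + (w + x) ≡ (u + w) + (v + x)
  interchange = solve-∀

*-distribˡ-∑ : ∀ c f n → c * ∑ f n ≡ ∑ (λ j → c * f j) n
*-distribˡ-∑ c f zero = *-zeroʳ c
*-distribˡ-∑ c f (suc n) =
  trans (*-distribˡ-+ c (f 0) _) (cong (c * f 0 +_) (*-distribˡ-∑ c (f ∘ suc) n))

∑-split : ∀ f m n → ∑ f (m + n) ≡ ∑ f m + ∑ (λ j → f (m + j)) n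
∑-split f zero n = refl
∑-split f (suc m) n = trans (cong (f 0 +_) (∑-split (f ∘ suc) m n)) (sym (+-assoc (f 0) _ _))

∑-suc : ∀ f n → ∑ f (suc n) ≡ ∑ f n + f n
∑-suc f zero = +-identityʳ (f 0)
∑-suc f (suc n) = trans (cong (f 0 +_) (∑-suc (f ∘ suc) n)) (sym (+-assoc (f 0) _ _))

∑-monoˡ-≤ : ∀ f {m n} → m ≤ n → ∑ f m ≤ ∑ f n
∑-monoˡ-≤ f {m} m≤n =
  let o , m+o≡n = m≤n⇒∃[o]m+o≡n m≤n
  in subst (λ k → ∑ f m ≤ ∑ f k) m+o≡n (subst (∑ f m ≤_) (sym (∑-split f m o)) (m≤m+n _ _))

∑-blocks : ∀ f c A → ∑ f (c * A) ≡ ∑ (λ t → ∑ (λ r → f (t * A + r)) A) c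
∑-blocks f zero A = refl
∑-blocks f (suc c) A = trans (∑-split f A (c * A)) (cong (∑ f A +_) (trans
  (∑-blocks (λ j → f (A + j)) c A)
  (∑-cong c (λ t _ → ∑-cong A (λ r _ → cong f (sym (+-assoc A (t * A) r)))))))

∑-≤-+∑∸1 : ∀ f n → ∑ f n ≤ n + ∑ (λ j → f j ∸ 1) n
∑-≤-+∑∸1 f n = begin
  ∑ f n                                ≤⟨ ∑-mono-≤ n (λ j _ → m≤n+m∸n (f j) 1) ⟩
  ∑ (λ j → 1 + (f j ∸ 1)) n            ≡⟨ ∑-distrib-+ (λ _ → 1) (λ j → f j ∸ 1) n ⟩
  ∑ (λ _ → 1) n + ∑ (λ j → f j ∸ 1) n  ≡⟨ cong (_+ ∑ (λ j → f j ∸ 1) n) (trans (∑-const 1 n) (*-identityʳ n)) ⟩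
  n + ∑ (λ j → f j ∸ 1) n              ∎
  where open ≤-Reasoning

sum-map-applyUpTo : ∀ (F g : ℕ → ℕ) n → sum (map F (applyUpTo g n)) ≡ ∑ (F ∘ g) n
sum-map-applyUpTo F g zero = refl
sum-map-applyUpTo F g (suc n) = cong (F (g 0) +_) (sum-map-applyUpTo F (g ∘ suc) n)

2*∑-id : ∀ r → 2 * ∑ id (suc r) ≡ suc r * r
2*∑-id zero = refl
2*∑-id (suc r) = begin
  2 * ∑ id (suc (suc r))        ≡⟨ cong (2 *_) (∑-suc id (suc r)) ⟩
  2 * (∑ id (suc r) + suc r)    ≡⟨ *-distribˡ-+ 2 (∑ id (suc r)) (suc r) ⟩
  2 * ∑ id (suc r) + 2 * suc r  ≡⟨ cong (_+ 2 * suc r) (2*∑-id r) ⟩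
  suc r * r + 2 * suc r         ≡⟨ expand r ⟩
  suc (suc r) * suc r           ∎
  where
  open ≡-Reasoning
  expand : ∀ r → suc r * r + 2 * suc r ≡ suc (suc r) * suc r
  expand = solve-∀

tetra : ℕ → ℕ
tetra zero = 0
tetra (suc q) = tetra q + ∑ id (suc q)

6*tetra : ∀ r → 6 * tetra (suc r) ≡ suc (suc r) * suc r * r
6*tetra zero = refl
6*tetra (suc r) = begin
  6 * (tetra (suc r) + T)                              ≡⟨ *-distribˡ-+ 6 (tetra (suc r)) T ⟩
  6 * tetra (suc r) + 6 * T                            ≡⟨ cong₂ _+_ (6*tetra r) 6*T ⟩
  suc (suc r) * suc r * r + 3 * (suc (suc r) * suc r)  ≡⟨ expand r ⟩
  suc (suc (suc r)) * suc (suc r) * suc r              ∎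
  where
  open ≡-Reasoning
  T : ℕ
  T = ∑ id (suc (suc r))
  6*T : 6 * T ≡ 3 * (suc (suc r) * suc r)
  6*T = trans (*-assoc 3 2 T) (cong (3 *_) (2*∑-id (suc r)))
  expand : ∀ r →
    suc (suc r) * suc r * r + 3 * (suc (suc r) * suc r) ≡ suc (suc (suc r)) * suc (suc r) * suc r
  expand = solve-∀

cubic-dominates : ∀ k r → 24 * suc k ≤ r →
  suc (suc r) * suc (suc r) * (k * suc (suc r) + 1) ≤ suc r * tetra (suc r)
cubic-dominates k r 24k≤r = *-cancelˡ-≤ 6 (begin
  6 * (n * n * (k * n + 1))            ≤⟨ *-monoʳ-≤ 6 (*-monoʳ-≤ (n * n) (+-monoʳ-≤ (k * n) (s≤s z≤n))) ⟩
  6 * (n * n * (k * n + n))            ≡⟨ e₁ n k ⟩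
  n * (6 * suc k * (n * n))            ≤⟨ *-monoʳ-≤ n (*-monoʳ-≤ (6 * suc k) (*-mono-≤ n≤2q n≤2q)) ⟩
  n * (6 * suc k * (2 * q * (2 * q)))  ≡⟨ cong (n *_) (e₂ k q) ⟩
  n * (24 * suc k * (q * q))           ≤⟨ *-monoʳ-≤ n (*-monoˡ-≤ (q * q) 24k≤r) ⟩
  n * (r * (q * q))                    ≡⟨ e₃ n q r ⟩
  q * (n * q * r)                      ≡⟨ cong (q *_) (6*tetra r) ⟨
  q * (6 * tetra q)                    ≡⟨ e₄ q (tetra q) ⟩
  6 * (q * tetra q)                    ∎)
  where
  open ≤-Reasoning
  q n : ℕ
  q = suc r
  n = suc q
  n≤2q : n ≤ 2 * q
  n≤2q = ≤-trans (≤-reflexive (+-comm 1 q)) (+-monoʳ-≤ q (s≤s z≤n))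
  e₁ : ∀ n k → 6 * (n * n * (k * n + n)) ≡ n * (6 * suc k * (n * n))
  e₁ = solve-∀
  e₂ : ∀ k q → 6 * suc k * (2 * q * (2 * q)) ≡ 24 * suc k * (q * q)
  e₂ = solve-∀
  e₃ : ∀ n q r → n * (r * (q * q)) ≡ q * (n * q * r)
  e₃ = solve-∀
  e₄ : ∀ q x → q * (6 * x) ≡ 6 * (q * x)
  e₄ = solve-∀

a-≤-suc : ∀ n → a n ≤ a (suc n)
a-≤-suc zero = z≤n
a-≤-suc (suc zero) = s≤s z≤n
a-≤-suc (suc (suc n)) = ≤-trans (m≤m+n _ _) (m≤m+n _ (a (suc n)))

a-mono-≤ : ∀ {j l} → j ≤ l → a j ≤ a l
a-mono-≤ {j} j≤l = go (≤⇒≤′ j≤l)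
  where
  go : ∀ {l} → j ≤′ l → a j ≤ a l
  go ≤′-refl = ≤-refl
  go (≤′-step {l} j≤l) = ≤-trans (go j≤l) (a-≤-suc l)

a-cancel-< : ∀ {i B} → a i < a (suc B) → i ≤ B
a-cancel-< {i} {B} lt with i ≤? B
... | yes i≤B = i≤B
... | no i≰B = contradiction (a-mono-≤ (≰⇒> i≰B)) (<⇒≱ lt)

a-suc-nonZero : ∀ n → NonZero (a (suc n))
a-suc-nonZero n = >-nonZero (a-mono-≤ {1} {suc n} (s≤s z≤n))

n*a[n]≤a[1+n] : ∀ n → suc n * a (suc n) ≤ a (suc (suc n))
n*a[n]≤a[1+n] zero = s≤s z≤n
n*a[n]≤a[1+n] (suc n) = m≤m+n _ _

a[1+n]≤[1+n]*a[n] : ∀ n → a (suc (suc n)) ≤ suc (suc n) * a (suc n)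
a[1+n]≤[1+n]*a[n] zero = ≤-refl
a[1+n]≤[1+n]*a[n] (suc n) = ≤-trans (+-monoʳ-≤ (suc (suc n) * a (suc (suc n))) (a-≤-suc (suc n)))
  (≤-reflexive (+-comm _ (a (suc (suc n)))))

width : ℕ → ℕ
width n = a (suc n) ∸ a n

width-≤ : ∀ r → width (suc (suc r)) ≤ suc (suc r) * (suc (suc r) * a (suc r))
width-≤ r = begin
  width n              ≤⟨ m≤n+o⇒m∸n≤o (a (suc n)) (a n) (a[1+n]≤[1+n]*a[n] (suc r)) ⟩
  n * a n              ≤⟨ *-monoʳ-≤ n (a[1+n]≤[1+n]*a[n] r) ⟩
  n * (n * a (suc r))  ∎
  where
  open ≤-Reasoning
  n : ℕ
  n = suc (suc r)

sum-map-range : ∀ (F : ℕ → ℕ) n → sum (map F (range n)) ≡ ∑ (λ j → F (a n + j)) (width n)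
sum-map-range F n = trans (cong sum (sym (map-∘ {g = F} {f = a n +_} (upTo (width n)))))
  (sum-map-applyUpTo (F ∘ (a n +_)) id (width n))

-- Greedy digit sums

digitSum : ℕ → ℕ → ℕ
digitSum zero m = 0
digitSum (suc j) m = m / A + digitSum j (m % A)
  where
  A : ℕ
  A = a (suc j)
  instance
    A-nonZero : NonZero A
    A-nonZero = a-suc-nonZero j

digitSum-digit : ∀ j x {Q} → Q < a (suc j) → digitSum (suc j) (x * a (suc j) + Q) ≡ x + digitSum j Q
digitSum-digit j x {Q} Q< = cong₂ _+_ quotient (cong (digitSum j) remainder)
  where
  A : ℕ
  A = a (suc j)
  instance
    A-nonZero : NonZero A
    A-nonZero = a-suc-nonZero j
  quotient : (x * A + Q) / A ≡ x
  quotient = begin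
    (x * A + Q) / A    ≡⟨ +-distrib-/-∣ˡ Q (n∣m*n x) ⟩
    x * A / A + Q / A  ≡⟨ cong₂ _+_ (m*n/n≡m x A) (m<n⇒m/n≡0 Q<) ⟩
    x + 0              ≡⟨ +-identityʳ x ⟩
    x                  ∎
    where open ≡-Reasoning
  remainder : (x * A + Q) % A ≡ Q
  remainder = trans (cong (_% A) (+-comm (x * A) Q)) (trans ([m+kn]%n≡m%n Q x A) (m<n⇒m%n≡m Q<))

digitSum-suc : ∀ j {m} → m < a (suc j) → digitSum (suc j) m ≡ digitSum j m
digitSum-suc j = digitSum-digit j 0

digitSum-stable : ∀ {j l m} → j ≤ l → m < a (suc j) → digitSum l m ≡ digitSum j m
digitSum-stable {j} {m = m} j≤l m< = go (≤⇒≤′ j≤l)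
  where
  go : ∀ {l} → j ≤′ l → digitSum l m ≡ digitSum j m
  go ≤′-refl = refl
  go (≤′-step {l} j≤l) = trans (digitSum-suc l (<-≤-trans m< (a-mono-≤ (s≤s (≤′⇒≤ j≤l))))) (go j≤l)

digitSum-irrelevant : ∀ {j l m} → m < a (suc j) → m < a (suc l) → digitSum j m ≡ digitSum l m
digitSum-irrelevant {j} {l} mj ml with ≤-total j l
... | inj₁ j≤l = sym (digitSum-stable j≤l mj)
... | inj₂ l≤j = digitSum-stable l≤j ml

totalDigitSum : ℕ → ℕ
totalDigitSum q = ∑ (digitSum q) (a (suc q))

-- Below (q+1)·a(q+1) the numbers are t·a(q+1) + r with r < a(q+1), of digit sum t + digitSum q r.
totalDigitSum-suc-≥ : ∀ q → a (suc q) * ∑ id (suc q) + suc q * totalDigitSum q ≤ totalDigitSum (suc q)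
totalDigitSum-suc-≥ q = begin
  A * ∑ id (suc q) + suc q * S
    ≡⟨ cong₂ _+_ (*-distribˡ-∑ A id (suc q)) (sym (∑-const S (suc q))) ⟩
  ∑ (λ t → A * t) (suc q) + ∑ (λ _ → S) (suc q)
    ≡⟨ ∑-distrib-+ (λ t → A * t) (λ _ → S) (suc q) ⟨
  ∑ (λ t → A * t + S) (suc q)
    ≡⟨ ∑-cong (suc q) (λ t _ → block t) ⟩
  ∑ (λ t → ∑ (λ r → t + digitSum q r) A) (suc q)
    ≡⟨ ∑-cong (suc q) (λ t _ → ∑-cong A (λ r r< → digitSum-digit q t r<)) ⟨
  ∑ (λ t → ∑ (λ r → digitSum (suc q) (t * A + r)) A) (suc q)
    ≡⟨ ∑-blocks (digitSum (suc q)) (suc q) A ⟨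
  ∑ (digitSum (suc q)) (suc q * A)
    ≤⟨ ∑-monoˡ-≤ (digitSum (suc q)) (n*a[n]≤a[1+n] q) ⟩
  totalDigitSum (suc q)
    ∎
  where
  open ≤-Reasoning
  A S : ℕ
  A = a (suc q)
  S = totalDigitSum q
  block : ∀ t → A * t + S ≡ ∑ (λ r → t + digitSum q r) A
  block t = trans (cong (_+ S) (sym (∑-const t A))) (sym (∑-distrib-+ (λ _ → t) (digitSum q) A))

totalDigitSum-≥ : ∀ q → a q * tetra q ≤ totalDigitSum q
totalDigitSum-≥ zero = z≤n
totalDigitSum-≥ (suc q) = begin
  A * (tetra q + T)                ≡⟨ trans (*-distribˡ-+ A (tetra q) T) (+-comm _ (A * T)) ⟩
  A * T + A * tetra q              ≤⟨ +-monoʳ-≤ (A * T) (a-suc*tetra≤ q) ⟩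
  A * T + suc q * (a q * tetra q)  ≤⟨ +-monoʳ-≤ (A * T) (*-monoʳ-≤ (suc q) (totalDigitSum-≥ q)) ⟩
  A * T + suc q * totalDigitSum q  ≤⟨ totalDigitSum-suc-≥ q ⟩
  totalDigitSum (suc q)            ∎
  where
  open ≤-Reasoning
  A T : ℕ
  A = a (suc q)
  T = ∑ id (suc q)
  a-suc*tetra≤ : ∀ q → a (suc q) * tetra q ≤ suc q * (a q * tetra q)
  a-suc*tetra≤ zero = z≤n
  a-suc*tetra≤ (suc r) = ≤-trans (*-monoˡ-≤ (tetra (suc r)) (a[1+n]≤[1+n]*a[n] r))
    (≤-reflexive (*-assoc (suc (suc r)) (a (suc r)) (tetra (suc r))))

totalDigitSum-suc-split : ∀ q →
  totalDigitSum (suc q) ≡ totalDigitSum q + ∑ (λ j → digitSum (suc q) (a (suc q) + j)) (width (suc q))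
totalDigitSum-suc-split q = begin
  ∑ (digitSum (suc q)) (a (suc (suc q)))    ≡⟨ cong (∑ (digitSum (suc q))) (m+[n∸m]≡n (a-≤-suc (suc q))) ⟨
  ∑ (digitSum (suc q)) (A + width (suc q))  ≡⟨ ∑-split (digitSum (suc q)) A (width (suc q)) ⟩
  ∑ (digitSum (suc q)) A + top              ≡⟨ cong (_+ top) (∑-cong A (λ m m< → digitSum-suc q m<)) ⟩
  totalDigitSum q + top                     ∎
  where
  open ≡-Reasoning
  A top : ℕ
  A = a (suc q)
  top = ∑ (λ j → digitSum (suc q) (A + j)) (width (suc q))

digitSum-range-≥ : ∀ q →
  q * totalDigitSum q ≤ ∑ (λ j → digitSum (suc q) (a (suc q) + j)) (width (suc q))
digitSum-range-≥ q = +-cancelˡ-≤ S _ _ (begin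
  suc q * S                         ≤⟨ m≤n+m _ (a (suc q) * ∑ id (suc q)) ⟩
  a (suc q) * ∑ id (suc q) + suc q * S  ≤⟨ totalDigitSum-suc-≥ q ⟩
  totalDigitSum (suc q)             ≡⟨ totalDigitSum-suc-split q ⟩
  S + ∑ (λ j → digitSum (suc q) (a (suc q) + j)) (width (suc q))  ∎)
  where
  open ≤-Reasoning
  S : ℕ
  S = totalDigitSum q

-- Legal decompositions are greedy

-- Q is the value of the coefficients of indices ≤ j and p the coefficient of index j.  The second
-- component leaves room for the full coefficient j + 1, which legality allows exactly when p = 0.
Room : ℕ → ℕ → ℕ → Set
Room j p Q = Q < a (suc j) × (p ≡ 0 → suc j * a (suc j) + Q < a (suc (suc j)))

room-step : ∀ {j p Q x} → x ≤ suc j → (x ≡ suc j → p ≡ 0) → Room j p Q →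
  Room (suc j) x (x * a (suc j) + Q)
room-step {j} {Q = Q} {x} x≤ x≡→p≡0 (Q< , full) = below , fullNext
  where
  below : x * a (suc j) + Q < a (suc (suc j))
  below with x ≟ suc j
  ... | yes refl = full (x≡→p≡0 refl)
  ... | no x≢ = begin-strict
    x * a (suc j) + Q          <⟨ +-monoʳ-< (x * a (suc j)) Q< ⟩
    x * a (suc j) + a (suc j)  ≡⟨ +-comm (x * a (suc j)) (a (suc j)) ⟩
    suc x * a (suc j)          ≤⟨ *-monoˡ-≤ (a (suc j)) (≤∧≢⇒< x≤ x≢) ⟩
    suc j * a (suc j)          ≤⟨ n*a[n]≤a[1+n] j ⟩
    a (suc (suc j))            ∎
    where open ≤-Reasoning
  fullNext : x ≡ 0 → suc (suc j) * a (suc (suc j)) + (x * a (suc j) + Q) < a (suc (suc (suc j)))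
  fullNext refl = +-monoʳ-< (suc (suc j) * a (suc (suc j))) Q<

legal-digitSum : ∀ xs {j p Q} → legalFrom (suc j) p xs → Room j p Q →
  ∃[ l ] (valueFrom (suc j) xs + Q < a (suc l)
         × digitSum l (valueFrom (suc j) xs + Q) ≡ digitSum j Q + sum xs)
legal-digitSum [] {j} _ (Q< , _) = j , Q< , sym (+-identityʳ _)
legal-digitSum (x ∷ xs) {j} {Q = Q} (x≤ , x≡→p≡0 , legal) room =
  let l , bound , digits = legal-digitSum xs legal (room-step x≤ x≡→p≡0 room)
  in l , subst (_< a (suc l)) regroup bound , (begin
    digitSum l (valueFrom (suc j) (x ∷ xs) + Q)    ≡⟨ cong (digitSum l) regroup ⟨
    digitSum l (rest + (x * a (suc j) + Q))        ≡⟨ digits ⟩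
    digitSum (suc j) (x * a (suc j) + Q) + sum xs  ≡⟨ cong (_+ sum xs) (digitSum-digit j x (proj₁ room)) ⟩
    (x + digitSum j Q) + sum xs                    ≡⟨ shuffle x (digitSum j Q) (sum xs) ⟩
    digitSum j Q + (x + sum xs)                    ∎)
  where
  open ≡-Reasoning
  shuffle : ∀ u v w → (u + v) + w ≡ v + (u + w)
  shuffle = solve-∀
  rest : ℕ
  rest = valueFrom (suc (suc j)) xs
  regroup : rest + (x * a (suc j) + Q) ≡ valueFrom (suc j) (x ∷ xs) + Q
  regroup = sym (shuffle (x * a (suc j)) rest Q)

legalDecomp-sum : ∀ {s m n} → LegalDecomp s m → m < a (suc n) → sum s ≡ digitSum n m
legalDecomp-sum {s} {m} {n} (legal , value≡m) m< =
  let l , bound , digits = legal-digitSum s legal (s≤s z≤n , λ _ → s≤s (s≤s z≤n))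
  in begin
    sum s                     ≡⟨ digits ⟨
    digitSum l (value s + 0)  ≡⟨ cong (digitSum l) m≡value+0 ⟨
    digitSum l m              ≡⟨ digitSum-irrelevant {l} {n} (subst (_< a (suc l)) (sym m≡value+0) bound) m< ⟩
    digitSum n m              ∎
  where
  open ≡-Reasoning
  m≡value+0 : m ≡ value s + 0
  m≡value+0 = trans (sym value≡m) (sym (+-identityʳ (value s)))

length-gaps : ∀ L → length (gaps L) ≡ length L ∸ 1
length-gaps [] = refl
length-gaps (x ∷ []) = refl
length-gaps (x ∷ y ∷ L) = cong suc (length-gaps (y ∷ L))

length-summandsFrom : ∀ i xs → length (summandsFrom i xs) ≡ sum xs
length-summandsFrom i [] = refl
length-summandsFrom i (x ∷ xs) =
  trans (length-++ (replicate x i)) (cong₂ _+_ (length-replicate x) (length-summandsFrom (suc i) xs))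

numGaps≡sum∸1 : ∀ s → numGaps s ≡ sum s ∸ 1
numGaps≡sum∸1 s = trans (length-gaps (summands s)) (cong (_∸ 1) (length-summandsFrom 1 s))

countNonzero : List ℕ → ℕ
countNonzero L = length (filter (λ g → ¬? (g ≟ 0)) L)

countNonzero-∷-≤ : ∀ g L → countNonzero (g ∷ L) ≤ suc (countNonzero L)
countNonzero-∷-≤ g L with does (¬? (g ≟ 0))
... | false = n≤1+n _
... | true = ≤-refl

countNonzero-∷-≥ : ∀ g L → countNonzero L ≤ countNonzero (g ∷ L)
countNonzero-∷-≥ g L with does (¬? (g ≟ 0))
... | false = ≤-refl
... | true = n≤1+n _

countNonzero-gaps-replicate : ∀ i r L →
  countNonzero (gaps (i ∷ replicate r i ++ L)) ≡ countNonzero (gaps (i ∷ L))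
countNonzero-gaps-replicate i zero L = refl
countNonzero-gaps-replicate i (suc r) L rewrite n∸n≡0 i = countNonzero-gaps-replicate i r L

countNonzero-gaps-summandsFrom : ∀ xs {i p B} → p ≤ i → p ≤ B → valueFrom i xs < a (suc B) →
  p + countNonzero (gaps (p ∷ summandsFrom i xs)) ≤ B
countNonzero-gaps-summandsFrom [] {p = p} _ p≤B _ = ≤-trans (≤-reflexive (+-identityʳ p)) p≤B
countNonzero-gaps-summandsFrom (zero ∷ xs) p≤i p≤B v< =
  countNonzero-gaps-summandsFrom xs (m≤n⇒m≤1+n p≤i) p≤B v<
countNonzero-gaps-summandsFrom (suc x ∷ xs) {i} {p} {B} p≤i _ v< = step (m≤n⇒m<n∨m≡n p≤i)
  where
  open ≤-Reasoning
  gs : List ℕ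
  gs = gaps (i ∷ replicate x i ++ summandsFrom (suc i) xs)
  i≤B : i ≤ B
  i≤B = a-cancel-< (≤-<-trans (≤-trans (m≤m+n (a i) (x * a i)) (m≤m+n _ _)) v<)
  tail≤ : i + countNonzero gs ≤ B
  tail≤ = subst (λ c → i + c ≤ B) (sym (countNonzero-gaps-replicate i x _))
    (countNonzero-gaps-summandsFrom xs (n≤1+n i) i≤B (≤-<-trans (m≤n+m _ _) v<))
  step : p < i ⊎ p ≡ i → p + countNonzero ((i ∸ p) ∷ gs) ≤ B
  step (inj₂ p≡i) rewrite p≡i | n∸n≡0 i = tail≤
  step (inj₁ p<i) = begin
    p + countNonzero ((i ∸ p) ∷ gs)  ≤⟨ +-monoʳ-≤ p (countNonzero-∷-≤ (i ∸ p) gs) ⟩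
    p + suc (countNonzero gs)        ≡⟨ +-suc p _ ⟩
    suc p + countNonzero gs          ≤⟨ +-monoˡ-≤ _ p<i ⟩
    i + countNonzero gs              ≤⟨ tail≤ ⟩
    B                                ∎

numNonzeroGaps≤ : ∀ s {B} → value s < a (suc B) → numNonzeroGaps s ≤ B
numNonzeroGaps≤ s v< with summandsFrom 1 s | countNonzero-gaps-summandsFrom s z≤n z≤n v<
... | [] | _ = z≤n
... | y ∷ L | bound = ≤-trans (countNonzero-∷-≥ (y ∸ 0) (gaps (y ∷ L))) bound

module _ (dec : ℕ → List ℕ) (legal : ∀ m → 1 ≤ m → LegalDecomp (dec m) m) where

  legal-range : ∀ q {j} → j < width (suc q) →
    LegalDecomp (dec (a (suc q) + j)) (a (suc q) + j) × a (suc q) + j < a (suc (suc q))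
  legal-range q {j} j< =
    legal _ (≤-trans (a-mono-≤ {1} {suc q} (s≤s z≤n)) (m≤m+n _ j)) ,
    subst (a (suc q) + j <_) (m+[n∸m]≡n (a-≤-suc (suc q))) (+-monoʳ-< (a (suc q)) j<)

  N-≤ : ∀ q → N dec (suc q) ≤ width (suc q) * suc q
  N-≤ q = begin
    N dec n                                             ≡⟨ sum-map-range _ n ⟩
    ∑ (λ j → numNonzeroGaps (dec (a n + j))) (width n)  ≤⟨ ∑-mono-≤ (width n) bound ⟩
    ∑ (λ _ → n) (width n)                               ≡⟨ ∑-const n (width n) ⟩
    width n * n                                         ∎
    where
    open ≤-Reasoning
    n : ℕ
    n = suc q
    bound : ∀ j → j < width n → numNonzeroGaps (dec (a n + j)) ≤ n
    bound j j< =
      let (_ , value≡m) , m< = legal-range q j<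
      in numNonzeroGaps≤ (dec (a n + j)) (subst (_< a (suc n)) (sym value≡m) m<)

  G-≥ : ∀ q → q * (a q * tetra q) ≤ width (suc q) + G dec (suc q)
  G-≥ q = begin
    q * (a q * tetra q)                                     ≤⟨ *-monoʳ-≤ q (totalDigitSum-≥ q) ⟩
    q * totalDigitSum q                                     ≤⟨ digitSum-range-≥ q ⟩
    ∑ (λ j → digitSum n (a n + j)) (width n)                ≤⟨ ∑-≤-+∑∸1 _ (width n) ⟩
    width n + ∑ (λ j → digitSum n (a n + j) ∸ 1) (width n)  ≡⟨ cong (width n +_) (∑-cong (width n) gaps≡) ⟨
    width n + ∑ (λ j → numGaps (dec (a n + j))) (width n)   ≡⟨ cong (width n +_) (sum-map-range _ n) ⟨
    width n + G dec n                                       ∎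
    where
    open ≤-Reasoning
    n : ℕ
    n = suc q
    gaps≡ : ∀ j → j < width n → numGaps (dec (a n + j)) ≡ digitSum n (a n + j) ∸ 1
    gaps≡ j j< =
      let legalDecomp , m< = legal-range q j<
      in trans (numGaps≡sum∸1 (dec (a n + j))) (cong (_∸ 1) (legalDecomp-sum {n = n} legalDecomp m<))

theorem1p4 : (dec : ℕ → List ℕ) → (∀ m → 1 ≤ m → LegalDecomp (dec m) m) →
    ∀ k → ∃[ M ] (∀ n → M ≤ n → k * N dec n ≤ G dec n)
theorem1p4 dec legal k = 2 + 24 * suc k , eventually
  where
  eventually : ∀ n → 2 + 24 * suc k ≤ n → k * N dec n ≤ G dec n
  eventually _ (s≤s (s≤s {n = r} 24k≤r)) = +-cancelˡ-≤ D _ _ (begin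
    D + k * N dec n              ≤⟨ +-monoʳ-≤ D (*-monoʳ-≤ k (N-≤ dec legal q)) ⟩
    D + k * (D * n)              ≡⟨ factor D k n ⟩
    D * (k * n + 1)              ≤⟨ *-monoˡ-≤ (k * n + 1) (width-≤ r) ⟩
    n * (n * a q) * (k * n + 1)  ≡⟨ regroup n (a q) k ⟩
    a q * (n * n * (k * n + 1))  ≤⟨ *-monoʳ-≤ (a q) (cubic-dominates k r 24k≤r) ⟩
    a q * (q * tetra q)          ≡⟨ swap (a q) q (tetra q) ⟩
    q * (a q * tetra q)          ≤⟨ G-≥ dec legal q ⟩
    D + G dec n                  ∎)
    where
    open ≤-Reasoning
    q n D : ℕ
    q = suc r
    n = suc q
    D = width n
    factor : ∀ D k n → D + k * (D * n) ≡ D * (k * n + 1)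
    factor = solve-∀
    regroup : ∀ n x k → n * (n * x) * (k * n + 1) ≡ x * (n * n * (k * n + 1))
    regroup = solve-∀
    swap : ∀ x q t → x * (q * t) ≡ q * (x * t)
    swap = solve-∀
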